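{- Let $n\ge 6$, with vertex labels taken modulo $n$. Let $T$ be a 2-triangulation of a convex $n$-gon and let $a$ be a vertex with $\deg(a)=0$. Then $T$ contains the diagonal joining $a-2$ and $a+1$ and the diagonal joining $a-1$ and $a+2$.
   Context: The vertices of the convex $n$-gon are labeled $1,\dots,n$ clockwise (labels modulo $n$). Two diagonals cross if they intersect in their interiors. A 2-triangulation is a maximal set of diagonals no three of which pairwise cross. A diagonal joining two vertices at cyclic distance $2$ is called trivial (every 2-triangulation contains all of them). The degree $\deg(v)$ of a vertex $v$ in $T$ is the number of nontrivial diagonals of $T$ having $v$ as an endpoint. -}

module Defs where

open import Data.Nat using (ℕ; zero; suc; _+_; _∸_; _≤_; _<_; _⊔_; _⊓_; _≤ᵇ_; NonZero)
open import Data.Nat.DivMod using (_%_; m%n<n)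
open import Data.Fin using (Fin; toℕ; fromℕ<)
open import Data.Fin.Properties using ()
open import Data.Bool using (Bool; true; false; _∧_; if_then_else_)
open import Data.List using (List; map; allFin)
open import Data.Nat.ListAction using (sum)
open import Data.Product using (Σ; _×_; ∃; ∃-syntax)
open import Data.Sum using (_⊎_)
open import Relation.Nullary using (¬_)
open import Relation.Binary.PropositionalEquality using (_≡_)

-- Vertices of the convex n-gon: Fin n, labels 0,…,n-1 in clockwise order
-- (the paper's labels 1,…,n taken modulo n).

vtx : (n : ℕ) → .{{_ : NonZero n}} → ℕ → Fin n
vtx n k = fromℕ< (m%n<n k n)

plusV : {n : ℕ} → .{{_ : NonZero n}} → Fin n → ℕ → Fin n
plusV {n} a k = vtx n (toℕ a + k)

minusV : {n : ℕ} → .{{_ : NonZero n}} → Fin n → ℕ → Fin n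
minusV {n} a k = vtx n (toℕ a + n ∸ k)

absDiff : ℕ → ℕ → ℕ
absDiff x y = (x ∸ y) + (y ∸ x)

cdist : {n : ℕ} → Fin n → Fin n → ℕ
cdist {n} u v = absDiff (toℕ u) (toℕ v) ⊓ (n ∸ absDiff (toℕ u) (toℕ v))

IsDiagonal : {n : ℕ} → Fin n → Fin n → Set
IsDiagonal u v = 2 ≤ cdist u v

nontrivialᵇ : {n : ℕ} → Fin n → Fin n → Bool
nontrivialᵇ u v = 3 ≤ᵇ cdist u v

Inside : {n : ℕ} → Fin n → Fin n → Fin n → Set
Inside a b c = (toℕ a ⊓ toℕ b < toℕ c) × (toℕ c < toℕ a ⊔ toℕ b)

Outside : {n : ℕ} → Fin n → Fin n → Fin n → Set
Outside a b c = (toℕ c < toℕ a ⊓ toℕ b) ⊎ (toℕ a ⊔ toℕ b < toℕ c)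

-- the chords {a,b} and {c,d} of the convex polygon cross (meet in their interiors)
Cross : {n : ℕ} → Fin n → Fin n → Fin n → Fin n → Set
Cross a b c d = (Inside a b c × Outside a b d) ⊎ (Outside a b c × Inside a b d)

record DiagonalSet (n : ℕ) : Set where
  field
    mem      : Fin n → Fin n → Bool
    mem-sym  : ∀ u v → mem u v ≡ mem v u
    mem-diag : ∀ u v → mem u v ≡ true → IsDiagonal u v
open DiagonalSet public

record Is2Triangulation {n : ℕ} (T : DiagonalSet n) : Set where
  field
    no3cross : ∀ a b c d e f →
      mem T a b ≡ true → mem T c d ≡ true → mem T e f ≡ true →
      ¬ (Cross a b c d × Cross a b e f × Cross c d e f)
    maximal : ∀ u v → IsDiagonal u v → mem T u v ≡ false →
      ∃[ a ] ∃[ b ] ∃[ c ] ∃[ d ]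
        (mem T a b ≡ true × mem T c d ≡ true ×
         Cross u v a b × Cross u v c d × Cross a b c d)

deg : {n : ℕ} → DiagonalSet n → Fin n → ℕ
deg {n} T v = sum (map (λ w → if mem T v w ∧ nontrivialᵇ v w then 1 else 0) (allFin n))

{-# OPTIONS --safe #-}
-- Since deg a = 0, the only diagonals of T at a are {a-2, a} and {a, a+2}.  Let {p, p+3} be a
-- chord with a ∈ {p+1, p+2} and e the other vertex strictly between p and p+3, and suppose
-- {p, p+3} ∉ T.  By maximality two mutually crossing diagonals of T both cross {p, p+3}, and
-- each of them ends at a or at e.  A diagonal of T at a crossing {p, p+3} is {a-2, a} or
-- {a, a+2} with middle vertex p or p+3, so every chord crossing it ends at p or p+3 and cannot
-- cross {p, p+3}.  Hence both diagonals end at e, and diagonals sharing an endpoint do not cross.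
module Submission where

open import Defs
open import Data.Nat
open import Data.Nat.Properties
open import Data.Nat.DivMod
open import Data.Nat.ListAction using (sum)
open import Data.Fin using (Fin; toℕ)
open import Data.Fin.Properties using (toℕ-fromℕ<; toℕ-injective; toℕ<n)
open import Data.Bool as Bool using (true; false; _∧_; if_then_else_)
open import Data.List using (_∷_; map; allFin)
open import Data.List.Membership.Propositional using (_∈_)
open import Data.List.Membership.Propositional.Properties using (∈-allFin)
open import Data.List.Relation.Unary.Any using (here; there)
open import Data.Product as Product using (_×_; _,_; ∃-syntax; proj₁; proj₂)
open import Data.Sum as Sum using (_⊎_; inj₁; inj₂)
open import Data.Empty using (⊥; ⊥-elim)
open import Function using (_∘_)
open import Relation.Nullary using (¬_; yes; no)
open import Relation.Binary.PropositionalEquality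

[m%n+k]%n≡[m+k]%n : ∀ m k n .{{_ : NonZero n}} → (m % n + k) % n ≡ (m + k) % n
[m%n+k]%n≡[m+k]%n m k n = begin
  (m % n + k) % n          ≡⟨ %-distribˡ-+ (m % n) k n ⟩
  (m % n % n + k % n) % n  ≡⟨ cong (λ r → (r + k % n) % n) (m%n%n≡m%n m n) ⟩
  (m % n + k % n) % n      ≡⟨ %-distribˡ-+ m k n ⟨
  (m + k) % n              ∎
  where open ≡-Reasoning

[m+k%n]%n≡[m+k]%n : ∀ m k n .{{_ : NonZero n}} → (m + k % n) % n ≡ (m + k) % n
[m+k%n]%n≡[m+k]%n m k n = begin
  (m + k % n) % n  ≡⟨ cong (_% n) (+-comm m (k % n)) ⟩
  (k % n + m) % n  ≡⟨ [m%n+k]%n≡[m+k]%n k m n ⟩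
  (k + m) % n      ≡⟨ cong (_% n) (+-comm k m) ⟩
  (m + k) % n      ∎
  where open ≡-Reasoning

m⊓[n∸m]≡k⇒m≡k⊎m≡n∸k : ∀ {m n k} → m ≤ n → m ⊓ (n ∸ m) ≡ k → m ≡ k ⊎ m ≡ n ∸ k
m⊓[n∸m]≡k⇒m≡k⊎m≡n∸k {m} {n} m≤n min≡k with ⊓-sel m (n ∸ m)
... | inj₁ min≡m   = inj₁ (trans (sym min≡m) min≡k)
... | inj₂ min≡n∸m = inj₂ (trans (sym (m∸[m∸n]≡n m≤n)) (cong (n ∸_) (trans (sym min≡n∸m) min≡k)))

absDiff-+ʳ : ∀ m k → absDiff m (m + k) ≡ k
absDiff-+ʳ m k = cong₂ _+_ (m≤n⇒m∸n≡0 (m≤m+n m k)) (m+n∸m≡n m k)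

absDiff-+ˡ : ∀ m k → absDiff (m + k) m ≡ k
absDiff-+ˡ m k = trans (cong₂ _+_ (m+n∸m≡n m k) (m≤n⇒m∸n≡0 (m≤m+n m k))) (+-identityʳ k)

absDiff-wrap : ∀ {c d k n} → k ≤ n → d + n ≡ c + k → absDiff c d ≡ n ∸ k
absDiff-wrap {c} {d} {k} {n} k≤n d+n≡c+k =
  trans (cong (λ x → absDiff x d) (sym d+[n∸k]≡c)) (absDiff-+ˡ d (n ∸ k))
  where
  open ≡-Reasoning
  d+[n∸k]≡c : d + (n ∸ k) ≡ c
  d+[n∸k]≡c = +-cancelʳ-≡ k (d + (n ∸ k)) c (begin
    d + (n ∸ k) + k  ≡⟨ +-assoc d (n ∸ k) k ⟩
    d + (n ∸ k + k)  ≡⟨ cong (d +_) (m∸n+n≡m k≤n) ⟩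
    d + n            ≡⟨ d+n≡c+k ⟩
    c + k            ∎)

module _ {n : ℕ} .{{_ : NonZero n}} where

  toℕ-plusV : ∀ c i → toℕ (plusV c i) ≡ (toℕ c + i) % n
  toℕ-plusV c i = toℕ-fromℕ< (m%n<n (toℕ c + i) n)

  toℕ%n≡toℕ : (z : Fin n) → toℕ z % n ≡ toℕ z
  toℕ%n≡toℕ z = m<n⇒m%n≡m (toℕ<n z)

  plusV-plusV : ∀ c i j → plusV (plusV c i) j ≡ plusV c (i + j)
  plusV-plusV c i j = toℕ-injective (begin
    toℕ (plusV (plusV c i) j)  ≡⟨ toℕ-plusV (plusV c i) j ⟩
    (toℕ (plusV c i) + j) % n  ≡⟨ cong (λ r → (r + j) % n) (toℕ-plusV c i) ⟩
    ((toℕ c + i) % n + j) % n  ≡⟨ [m%n+k]%n≡[m+k]%n (toℕ c + i) j n ⟩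
    (toℕ c + i + j) % n        ≡⟨ cong (_% n) (+-assoc (toℕ c) i j) ⟩
    (toℕ c + (i + j)) % n      ≡⟨ toℕ-plusV c (i + j) ⟨
    toℕ (plusV c (i + j))      ∎)
    where open ≡-Reasoning

  plusV-n : ∀ c → plusV c n ≡ c
  plusV-n c = toℕ-injective (trans (toℕ-plusV c n) (trans ([m+n]%n≡m%n (toℕ c) n) (toℕ%n≡toℕ c)))

  plusV-plusV-n : ∀ c {i j} → i + j ≡ n → plusV (plusV c i) j ≡ c
  plusV-plusV-n c {i} {j} i+j≡n = trans (plusV-plusV c i j) (trans (cong (plusV c) i+j≡n) (plusV-n c))

  minusV≡plusV : ∀ c {k} → k ≤ n → minusV c k ≡ plusV c (n ∸ k)
  minusV≡plusV c k≤n = cong (vtx n) (+-∸-assoc (toℕ c) k≤n)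

  plusV-minusV : ∀ c {k} → k ≤ n → plusV (minusV c k) k ≡ c
  plusV-minusV c {k} k≤n =
    trans (cong (λ v → plusV v k) (minusV≡plusV c k≤n)) (plusV-plusV-n c (m∸n+n≡m k≤n))

  plusV-minusV-+ : ∀ c {k} j → k ≤ n → plusV (minusV c k) (k + j) ≡ plusV c j
  plusV-minusV-+ c {k} j k≤n =
    trans (sym (plusV-plusV (minusV c k) k j)) (cong (λ v → plusV v j) (plusV-minusV c k≤n))

  plusV-reaches : ∀ c x → ∃[ i ] (i < n × plusV c i ≡ x)
  plusV-reaches c x = (X + n ∸ C) % n , m%n<n (X + n ∸ C) n , toℕ-injective (begin
    toℕ (plusV c ((X + n ∸ C) % n))  ≡⟨ toℕ-plusV c ((X + n ∸ C) % n) ⟩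
    (C + (X + n ∸ C) % n) % n        ≡⟨ [m+k%n]%n≡[m+k]%n C (X + n ∸ C) n ⟩
    (C + (X + n ∸ C)) % n            ≡⟨ cong (_% n) (m+[n∸m]≡n C≤X+n) ⟩
    (X + n) % n                      ≡⟨ [m+n]%n≡m%n X n ⟩
    X % n                            ≡⟨ toℕ%n≡toℕ x ⟩
    X                                ∎)
    where
    open ≡-Reasoning
    C = toℕ c
    X = toℕ x
    C≤X+n : C ≤ X + n
    C≤X+n = ≤-trans (<⇒≤ (toℕ<n c)) (m≤n+m n X)

  toℕ-plusV-cases : ∀ c {k} → k < n →
    toℕ (plusV c k) ≡ toℕ c + k ⊎ toℕ (plusV c k) + n ≡ toℕ c + k
  toℕ-plusV-cases c {k} k<n with toℕ c + k <? n
  ... | yes C+k<n = inj₁ (trans (toℕ-plusV c k) (m<n⇒m%n≡m C+k<n))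
  ... | no C+k≮n = inj₂ (begin
    toℕ (plusV c k) + n  ≡⟨ cong (_+ n) (toℕ-plusV c k) ⟩
    (C + k) % n + n      ≡⟨ cong (_+ n) (m≤n⇒[n∸m]%m≡n%m n≤C+k) ⟨
    (C + k ∸ n) % n + n  ≡⟨ cong (_+ n) (m<n⇒m%n≡m C+k∸n<n) ⟩
    C + k ∸ n + n        ≡⟨ m∸n+n≡m n≤C+k ⟩
    C + k                ∎)
    where
    open ≡-Reasoning
    C = toℕ c
    n≤C+k : n ≤ C + k
    n≤C+k = ≮⇒≥ C+k≮n
    C+k∸n<n : C + k ∸ n < n
    C+k∸n<n = m<n+o⇒m∸n<o (C + k) n (+-mono-< (toℕ<n c) k<n)

  cdist-plusV : ∀ c {k} → k < n → cdist c (plusV c k) ≡ k ⊓ (n ∸ k)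
  cdist-plusV c {k} k<n with toℕ-plusV-cases c k<n
  ... | inj₁ D≡C+k =
    cong (λ d → d ⊓ (n ∸ d)) (trans (cong (absDiff (toℕ c)) D≡C+k) (absDiff-+ʳ (toℕ c) k))
  ... | inj₂ D+n≡C+k = begin
    cdist c (plusV c k)      ≡⟨ cong (λ d → d ⊓ (n ∸ d)) (absDiff-wrap (<⇒≤ k<n) D+n≡C+k) ⟩
    (n ∸ k) ⊓ (n ∸ (n ∸ k))  ≡⟨ cong ((n ∸ k) ⊓_) (m∸[m∸n]≡n (<⇒≤ k<n)) ⟩
    (n ∸ k) ⊓ k              ≡⟨ ⊓-comm (n ∸ k) k ⟩
    k ⊓ (n ∸ k)              ∎
    where open ≡-Reasoning

  isDiagonal-plusV : ∀ c {k} → 2 ≤ k → 2 + k ≤ n → IsDiagonal c (plusV c k)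
  isDiagonal-plusV c 2≤k 2+k≤n =
    subst (2 ≤_) (sym (cdist-plusV c (m+n≤o⇒n≤o 1 2+k≤n))) (⊓-glb 2≤k (m+n≤o⇒m≤o∸n 2 2+k≤n))

  cdist≡2⇒±2 : 2 ≤ n → ∀ {u v} → cdist u v ≡ 2 → v ≡ plusV u 2 ⊎ v ≡ plusV u (n ∸ 2)
  cdist≡2⇒±2 2≤n {u} {v} cdist≡2 with plusV-reaches u v
  ... | i , i<n , refl =
    Sum.map (cong (plusV u)) (cong (plusV u))
      (m⊓[n∸m]≡k⇒m≡k⊎m≡n∸k (<⇒≤ i<n) (trans (sym (cdist-plusV u i<n)) cdist≡2))

-- Cross a b c d unfolds to Crossₙ (toℕ a ⊓ toℕ b) (toℕ a ⊔ toℕ b) (toℕ c) (toℕ d).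
Insideₙ : ℕ → ℕ → ℕ → Set
Insideₙ lo hi z = lo < z × z < hi

Outsideₙ : ℕ → ℕ → ℕ → Set
Outsideₙ lo hi z = z < lo ⊎ hi < z

Crossₙ : ℕ → ℕ → ℕ → ℕ → Set
Crossₙ lo hi x y = (Insideₙ lo hi x × Outsideₙ lo hi y) ⊎ (Outsideₙ lo hi x × Insideₙ lo hi y)

crossₙ-inside : ∀ {lo hi x y} → Crossₙ lo hi x y → Insideₙ lo hi x ⊎ Insideₙ lo hi y
crossₙ-inside = Sum.map proj₁ proj₂

crossₙ-outside : ∀ {lo hi x y} → Crossₙ lo hi x y → Outsideₙ lo hi x ⊎ Outsideₙ lo hi y
crossₙ-outside = Sum.swap ∘ Sum.map proj₂ proj₁

crossₙ-swap : ∀ {lo hi x y} → Crossₙ lo hi x y → Crossₙ lo hi y x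
crossₙ-swap = Sum.swap ∘ Sum.map Product.swap Product.swap

crossₙ-sort : ∀ {lo hi x y} → Crossₙ lo hi x y → Crossₙ lo hi (x ⊓ y) (x ⊔ y)
crossₙ-sort {lo} {hi} {x} {y} h with ≤-total x y
... | inj₁ x≤y = subst₂ (Crossₙ lo hi) (sym (m≤n⇒m⊓n≡m x≤y)) (sym (m≤n⇒m⊔n≡n x≤y)) h
... | inj₂ y≤x = subst₂ (Crossₙ lo hi) (sym (m≥n⇒m⊓n≡n y≤x)) (sym (m≥n⇒m⊔n≡m y≤x)) (crossₙ-swap h)

crossₙ-unsort : ∀ {lo hi x y} → Crossₙ lo hi (x ⊓ y) (x ⊔ y) → Crossₙ lo hi x y
crossₙ-unsort {lo} {hi} {x} {y} h with ≤-total x y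
... | inj₁ x≤y = subst₂ (Crossₙ lo hi) (m≤n⇒m⊓n≡m x≤y) (m≤n⇒m⊔n≡n x≤y) h
... | inj₂ y≤x = crossₙ-swap (subst₂ (Crossₙ lo hi) (m≥n⇒m⊓n≡n y≤x) (m≥n⇒m⊔n≡m y≤x) h)

crossₙ-sym : ∀ {lo hi lo′ hi′} → lo′ ≤ hi′ → Crossₙ lo hi lo′ hi′ → Crossₙ lo′ hi′ lo hi
crossₙ-sym lo′≤hi′ (inj₁ ((lo<lo′ , _) , inj₁ hi′<lo)) =
  ⊥-elim (<-asym lo<lo′ (≤-<-trans lo′≤hi′ hi′<lo))
crossₙ-sym _ (inj₁ ((lo<lo′ , lo′<hi) , inj₂ hi<hi′)) = inj₂ (inj₁ lo<lo′ , (lo′<hi , hi<hi′))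
crossₙ-sym _ (inj₂ (inj₁ lo′<lo , (lo<hi′ , hi′<hi))) = inj₁ ((lo′<lo , lo<hi′) , inj₂ hi′<hi)
crossₙ-sym lo′≤hi′ (inj₂ (inj₂ hi<lo′ , (_ , hi′<hi))) =
  ⊥-elim (<-asym hi′<hi (<-≤-trans hi<lo′ lo′≤hi′))

module _ {n : ℕ} {a b c d : Fin n} where

  cross-swapˡ : Cross a b c d → Cross b a c d
  cross-swapˡ = subst₂ (λ lo hi → Crossₙ lo hi (toℕ c) (toℕ d))
    (⊓-comm (toℕ a) (toℕ b)) (⊔-comm (toℕ a) (toℕ b))

  cross-swapʳ : Cross a b c d → Cross a b d c
  cross-swapʳ = crossₙ-swap

  cross-sym : Cross a b c d → Cross c d a b
  cross-sym = crossₙ-unsort ∘ crossₙ-sym (m⊓n≤m⊔n (toℕ c) (toℕ d)) ∘ crossₙ-sort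

module _ {n : ℕ} where

  Endpoint : Fin n → Fin n → Fin n → Set
  Endpoint v x y = v ≡ x ⊎ v ≡ y

  ¬inside-endpoint : ∀ {a b c : Fin n} → Endpoint c a b → ¬ Inside a b c
  ¬inside-endpoint {a} {b} (inj₁ refl) (lo<a , a<hi) with ≤-total (toℕ a) (toℕ b)
  ... | inj₁ a≤b = <-irrefl (m≤n⇒m⊓n≡m a≤b) lo<a
  ... | inj₂ b≤a = <-irrefl (sym (m≥n⇒m⊔n≡m b≤a)) a<hi
  ¬inside-endpoint {a} {b} (inj₂ refl) (lo<b , b<hi) with ≤-total (toℕ a) (toℕ b)
  ... | inj₁ a≤b = <-irrefl (sym (m≤n⇒m⊔n≡n a≤b)) b<hi
  ... | inj₂ b≤a = <-irrefl (m≥n⇒m⊓n≡n b≤a) lo<b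

  ¬outside-endpoint : ∀ {a b c : Fin n} → Endpoint c a b → ¬ Outside a b c
  ¬outside-endpoint {a} {b} (inj₁ refl) (inj₁ a<lo) = <⇒≱ a<lo (m⊓n≤m (toℕ a) (toℕ b))
  ¬outside-endpoint {a} {b} (inj₁ refl) (inj₂ hi<a) = <⇒≱ hi<a (m≤m⊔n (toℕ a) (toℕ b))
  ¬outside-endpoint {a} {b} (inj₂ refl) (inj₁ b<lo) = <⇒≱ b<lo (m⊓n≤n (toℕ a) (toℕ b))
  ¬outside-endpoint {a} {b} (inj₂ refl) (inj₂ hi<b) = <⇒≱ hi<b (m≤n⊔m (toℕ a) (toℕ b))

  ¬cross-endpoint : ∀ {a b c d : Fin n} → Endpoint c a b ⊎ Endpoint d a b → ¬ Cross a b c d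
  ¬cross-endpoint (inj₁ c∈ab) (inj₁ (c-in , _))  = ¬inside-endpoint c∈ab c-in
  ¬cross-endpoint (inj₁ c∈ab) (inj₂ (c-out , _)) = ¬outside-endpoint c∈ab c-out
  ¬cross-endpoint (inj₂ d∈ab) (inj₁ (_ , d-out)) = ¬outside-endpoint d∈ab d-out
  ¬cross-endpoint (inj₂ d∈ab) (inj₂ (_ , d-in))  = ¬inside-endpoint d∈ab d-in

  ¬cross-common-endpoint : ∀ {v a b c d : Fin n} → Endpoint v a b → Endpoint v c d → ¬ Cross a b c d
  ¬cross-common-endpoint v∈ab (inj₁ refl) = ¬cross-endpoint (inj₁ v∈ab)
  ¬cross-common-endpoint v∈ab (inj₂ refl) = ¬cross-endpoint (inj₂ v∈ab)

  NoCommonCrossing : (p q x y : Fin n) → Set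
  NoCommonCrossing p q x y = ∀ {z w} → Cross x y z w → ¬ Cross p q z w

  noCommonCrossing-swap : ∀ {p q x y} → NoCommonCrossing p q x y → NoCommonCrossing p q y x
  noCommonCrossing-swap none crosses = none (cross-swapˡ crosses)

module _ {n : ℕ} .{{_ : NonZero n}} where

  StrictlyWithin : Fin n → ℕ → Fin n → Set
  StrictlyWithin c k z = ∃[ i ] (0 < i × i < k × plusV c i ≡ z)

  strictlyWithin : ∀ c {k z} Z → toℕ c < Z → Z < toℕ c + k → Z % n ≡ toℕ z → StrictlyWithin c k z
  strictlyWithin c {k} Z C<Z Z<C+k Z%n≡z =
    Z ∸ toℕ c ,
    m<n⇒0<n∸m C<Z ,
    +-cancelˡ-< (toℕ c) (Z ∸ toℕ c) k (subst (_< toℕ c + k) (sym C+[Z∸C]≡Z) Z<C+k) ,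
    toℕ-injective (trans (toℕ-plusV c (Z ∸ toℕ c)) (trans (cong (_% n) C+[Z∸C]≡Z) Z%n≡z))
    where
    C+[Z∸C]≡Z : toℕ c + (Z ∸ toℕ c) ≡ Z
    C+[Z∸C]≡Z = m+[n∸m]≡n (<⇒≤ C<Z)

  -- Without wrap-around the vertices strictly between c and c+k are the labels inside the
  -- interval [c, c+k]; with wrap-around they are the labels outside [c+k-n, c].
  cross-plusV : ∀ c {k x y} → k < n → Cross c (plusV c k) x y →
    StrictlyWithin c k x ⊎ StrictlyWithin c k y
  cross-plusV c {k} {x} {y} k<n crosses with toℕ-plusV-cases c k<n
  ... | inj₁ D≡C+k =
    Sum.map inside inside (crossₙ-inside (subst₂ (λ lo hi → Crossₙ lo hi (toℕ x) (toℕ y))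
      (m≤n⇒m⊓n≡m C≤D) (m≤n⇒m⊔n≡n C≤D) crosses))
    where
    C≤D : toℕ c ≤ toℕ (plusV c k)
    C≤D = subst (toℕ c ≤_) (sym D≡C+k) (m≤m+n (toℕ c) k)
    inside : ∀ {z} → Insideₙ (toℕ c) (toℕ (plusV c k)) (toℕ z) → StrictlyWithin c k z
    inside {z} (C<Z , Z<D) =
      strictlyWithin c (toℕ z) C<Z (subst (toℕ z <_) D≡C+k Z<D) (toℕ%n≡toℕ z)
  ... | inj₂ D+n≡C+k =
    Sum.map outside outside (crossₙ-outside (subst₂ (λ lo hi → Crossₙ lo hi (toℕ x) (toℕ y))
      (m≥n⇒m⊓n≡n D≤C) (m≥n⇒m⊔n≡m D≤C) crosses))
    where
    C = toℕ c
    D = toℕ (plusV c k)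
    D≤C : D ≤ C
    D≤C = <⇒≤ (+-cancelʳ-< n D C (subst (_< C + n) (sym D+n≡C+k) (+-monoʳ-< C k<n)))
    n≤C+k : n ≤ C + k
    n≤C+k = subst (n ≤_) D+n≡C+k (m≤n+m n D)
    outside : ∀ {z} → Outsideₙ D C (toℕ z) → StrictlyWithin c k z
    outside {z} (inj₁ Z<D) =
      strictlyWithin c (toℕ z + n)
        (<-≤-trans (toℕ<n c) (m≤n+m n (toℕ z)))
        (subst (toℕ z + n <_) D+n≡C+k (+-monoˡ-< n Z<D))
        (trans ([m+n]%n≡m%n (toℕ z) n) (toℕ%n≡toℕ z))
    outside {z} (inj₂ C<Z) =
      strictlyWithin c (toℕ z) C<Z (<-≤-trans (toℕ<n z) n≤C+k) (toℕ%n≡toℕ z)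

  strictlyWithin-2 : ∀ {c z} → StrictlyWithin c 2 z → plusV c 1 ≡ z
  strictlyWithin-2 (1 , _ , _ , c+1≡z) = c+1≡z
  strictlyWithin-2 (suc (suc _) , _ , s≤s (s≤s ()) , _)

  strictlyWithin-3 : ∀ {c z} → StrictlyWithin c 3 z → plusV c 1 ≡ z ⊎ plusV c 2 ≡ z
  strictlyWithin-3 (1 , _ , _ , c+1≡z) = inj₁ c+1≡z
  strictlyWithin-3 (2 , _ , _ , c+2≡z) = inj₂ c+2≡z
  strictlyWithin-3 (suc (suc (suc _)) , _ , s≤s (s≤s (s≤s ())) , _)

  cross-span2 : ∀ {c x y} → 2 < n → Cross c (plusV c 2) x y → Endpoint (plusV c 1) x y
  cross-span2 2<n = Sum.map strictlyWithin-2 strictlyWithin-2 ∘ cross-plusV _ 2<n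

  cross-span3 : ∀ {c x y} → 3 < n → Cross c (plusV c 3) x y →
    Endpoint (plusV c 1) x y ⊎ Endpoint (plusV c 2) x y
  cross-span3 3<n crosses with cross-plusV _ 3<n crosses
  ... | inj₁ x-within = Sum.map inj₁ inj₁ (strictlyWithin-3 x-within)
  ... | inj₂ y-within = Sum.map inj₂ inj₂ (strictlyWithin-3 y-within)

  noCommonCrossing-span2 : ∀ {c p q} → 2 < n → Endpoint (plusV c 1) p q →
    NoCommonCrossing p q c (plusV c 2)
  noCommonCrossing-span2 2<n c+1∈pq crosses = ¬cross-common-endpoint c+1∈pq (cross-span2 2<n crosses)

module _ {n : ℕ} {T : DiagonalSet n} (tri : Is2Triangulation T) where

  mem-if-crossings-through : ∀ {p q a e} → IsDiagonal p q →
    (∀ {x y} → Cross p q x y → Endpoint a x y ⊎ Endpoint e x y) →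
    (∀ {y} → mem T a y ≡ true → Cross p q a y → NoCommonCrossing p q a y) →
    mem T p q ≡ true
  mem-if-crossings-through {p} {q} {a} {e} pq-diagonal through-a-or-e through-a-blocked
    with mem T p q in pq-mem
  ... | true  = refl
  ... | false with Is2Triangulation.maximal tri p q pq-diagonal pq-mem
  ... | x , y , z , w , xy∈T , zw∈T , pq×xy , pq×zw , xy×zw =
    ⊥-elim (impossible (through-a-or-e pq×xy) (through-a-or-e pq×zw))
    where
    blocked : ∀ {u v} → mem T u v ≡ true → Cross p q u v → Endpoint a u v → NoCommonCrossing p q u v
    blocked uv∈T pq×uv (inj₁ refl) = through-a-blocked uv∈T pq×uv
    blocked {u} {v} uv∈T pq×uv (inj₂ refl) =
      noCommonCrossing-swap (through-a-blocked (trans (mem-sym T v u) uv∈T) (cross-swapʳ pq×uv))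
    impossible : Endpoint a x y ⊎ Endpoint e x y → Endpoint a z w ⊎ Endpoint e z w → ⊥
    impossible (inj₁ a∈xy) _ = blocked xy∈T pq×xy a∈xy xy×zw pq×zw
    impossible _ (inj₁ a∈zw) = blocked zw∈T pq×zw a∈zw (cross-sym xy×zw) pq×xy
    impossible (inj₂ e∈xy) (inj₂ e∈zw) = ¬cross-common-endpoint e∈xy e∈zw xy×zw

sum-map≡0⇒≡0 : ∀ {A : Set} (f : A → ℕ) {x} xs → sum (map f xs) ≡ 0 → x ∈ xs → f x ≡ 0
sum-map≡0⇒≡0 f (y ∷ ys) sum≡0 (here refl)  = m+n≡0⇒m≡0 (f y) sum≡0
sum-map≡0⇒≡0 f (y ∷ ys) sum≡0 (there x∈ys) = sum-map≡0⇒≡0 f ys (m+n≡0⇒n≡0 (f y) sum≡0) x∈ys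

∧-indicator≡0 : ∀ {b c} → b ≡ true → (if b ∧ c then 1 else 0) ≡ 0 → c ≡ false
∧-indicator≡0 {c = false} _ _ = refl
∧-indicator≡0 {c = true} refl ()

module _ {n : ℕ} .{{_ : NonZero n}} (T : DiagonalSet n) where

  deg≡0⇒cdist≡2 : ∀ {a w} → deg T a ≡ 0 → mem T a w ≡ true → cdist a w ≡ 2
  deg≡0⇒cdist≡2 {a} {w} deg≡0 aw∈T = ≤-antisym (s≤s⁻¹ (≰⇒> ¬3≤cdist)) (mem-diag T a w aw∈T)
    where
    trivial : nontrivialᵇ a w ≡ false
    trivial = ∧-indicator≡0 aw∈T (sum-map≡0⇒≡0 _ (allFin n) deg≡0 (∈-allFin w))
    ¬3≤cdist : ¬ 3 ≤ cdist a w
    ¬3≤cdist 3≤cdist = subst Bool.T trivial (≤⇒≤ᵇ 3≤cdist)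

  deg≡0⇒neighbours : 2 ≤ n → ∀ {a y} → deg T a ≡ 0 → mem T a y ≡ true →
    y ≡ plusV a 2 ⊎ y ≡ plusV a (n ∸ 2)
  deg≡0⇒neighbours 2≤n deg≡0 ay∈T = cdist≡2⇒±2 2≤n (deg≡0⇒cdist≡2 deg≡0 ay∈T)

module _ {n : ℕ} .{{_ : NonZero n}} {T : DiagonalSet n} (tri : Is2Triangulation T) (6≤n : 6 ≤ n) where

  private
    2≤n : 2 ≤ n
    2≤n = ≤-trans (m≤m+n 2 4) 6≤n
    2<n : 2 < n
    2<n = ≤-trans (m≤m+n 3 3) 6≤n
    3<n : 3 < n
    3<n = ≤-trans (m≤m+n 4 2) 6≤n
    span3-diagonal : ∀ p → IsDiagonal p (plusV p 3)
    span3-diagonal p = isDiagonal-plusV p (m≤m+n 2 1) (≤-trans (m≤m+n 5 1) 6≤n)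

  deg[p+2]≡0⇒[p,p+3]∈T : ∀ p → deg T (plusV p 2) ≡ 0 → mem T p (plusV p 3) ≡ true
  deg[p+2]≡0⇒[p,p+3]∈T p deg≡0 =
    mem-if-crossings-through tri (span3-diagonal p)
      (λ crosses → Sum.swap (cross-span3 3<n crosses)) blocked
    where
    blocked : ∀ {y} → mem T (plusV p 2) y ≡ true → Cross p (plusV p 3) (plusV p 2) y →
      NoCommonCrossing p (plusV p 3) (plusV p 2) y
    blocked ay∈T pq×ay with deg≡0⇒neighbours T 2≤n deg≡0 ay∈T
    ... | inj₁ refl = noCommonCrossing-span2 2<n (inj₂ (plusV-plusV p 2 1))
    ... | inj₂ refl = ⊥-elim (¬cross-endpoint (inj₂ (inj₁ (plusV-plusV-n p (m+[n∸m]≡n 2≤n)))) pq×ay)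

  deg[p+1]≡0⇒[p,p+3]∈T : ∀ p → deg T (plusV p 1) ≡ 0 → mem T p (plusV p 3) ≡ true
  deg[p+1]≡0⇒[p,p+3]∈T p deg≡0 =
    mem-if-crossings-through tri (span3-diagonal p) (cross-span3 3<n) blocked
    where
    a = plusV p 1
    a-2 = plusV a (n ∸ 2)
    a-2+1≡p : plusV a-2 1 ≡ p
    a-2+1≡p = trans (cong (λ v → plusV v 1) (plusV-plusV p 1 (n ∸ 2)))
                  (plusV-plusV-n p (trans (sym (+-suc (n ∸ 2) 1)) (m∸n+n≡m 2≤n)))
    a-2+2≡a : plusV a-2 2 ≡ a
    a-2+2≡a = plusV-plusV-n a (m∸n+n≡m 2≤n)
    blocked : ∀ {y} → mem T a y ≡ true → Cross p (plusV p 3) a y → NoCommonCrossing p (plusV p 3) a y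
    blocked ay∈T pq×ay with deg≡0⇒neighbours T 2≤n deg≡0 ay∈T
    ... | inj₁ refl = ⊥-elim (¬cross-endpoint (inj₂ (inj₂ (plusV-plusV p 1 2))) pq×ay)
    ... | inj₂ refl = noCommonCrossing-swap
      (subst (NoCommonCrossing p (plusV p 3) a-2) a-2+2≡a (noCommonCrossing-span2 2<n (inj₁ a-2+1≡p)))

lemma3p4 : (n : ℕ) → .{{_ : NonZero n}} → 6 ≤ n →
    (T : DiagonalSet n) → Is2Triangulation T → (a : Fin n) → deg T a ≡ 0 →
    (mem T (minusV a 2) (plusV a 1) ≡ true) × (mem T (minusV a 1) (plusV a 2) ≡ true)
lemma3p4 n 6≤n T tri a deg≡0 =
  subst (λ q → mem T (minusV a 2) q ≡ true) (plusV-minusV-+ a 1 2≤n)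
    (deg[p+2]≡0⇒[p,p+3]∈T tri 6≤n (minusV a 2) (deg[a-k+k]≡0 2≤n)) ,
  subst (λ q → mem T (minusV a 1) q ≡ true) (plusV-minusV-+ a 2 1≤n)
    (deg[p+1]≡0⇒[p,p+3]∈T tri 6≤n (minusV a 1) (deg[a-k+k]≡0 1≤n))
  where
  1≤n : 1 ≤ n
  1≤n = ≤-trans (m≤m+n 1 5) 6≤n
  2≤n : 2 ≤ n
  2≤n = ≤-trans (m≤m+n 2 4) 6≤n
  deg[a-k+k]≡0 : ∀ {k} → k ≤ n → deg T (plusV (minusV a k) k) ≡ 0
  deg[a-k+k]≡0 k≤n = subst (λ v → deg T v ≡ 0) (sym (plusV-minusV a k≤n)) deg≡0
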